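{- The line graph $L(K_6)$ is total 4-uniform.
   Context: All graphs are finite and simple. $L(K_n)$ is the graph whose vertices are the 2-element subsets of $\{1,\dots,n\}$, two being adjacent iff they share an element. $N(v)$ is the set of neighbors of $v$. For a graph $G$ with no isolated vertices, a total dominating set is a set $A\subseteq V(G)$ such that every vertex of $G$ has a neighbor in $A$; $\gamma_t(G)$ is the minimum size of one. A sequence $(v_1,\dots,v_m)$ of distinct vertices is legal if $N(v_i)\setminus\bigcup_{j=1}^{i-1}N(v_j)\neq\emptyset$ for every $i\in\{2,\dots,m\}$; it is a total dominating sequence if moreover $\{v_1,\dots,v_m\}$ is a total dominating set. $\gamma_{gr}^t(G)$ is the maximum length of a total dominating sequence. $G$ is total $k$-uniform if $\gamma_t(G)=\gamma_{gr}^t(G)=k$. -}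

module Defs where

open import Data.Nat using (ℕ; _≤_; _<_)
open import Data.Fin using (Fin)
import Data.Fin as F
open import Data.Product using (Σ; ∃; _×_; _,_; proj₁; proj₂)
open import Data.Sum using (_⊎_)
open import Data.List using (List; []; _∷_; length; _++_)
open import Data.List.Membership.Propositional using (_∈_)
open import Data.List.Relation.Unary.Unique.Propositional using (Unique)
open import Relation.Binary.PropositionalEquality using (_≡_; _≢_)
open import Relation.Nullary using (¬_)

module _ {V : Set} (Adj : V → V → Set) where

  -- A total dominating set: every vertex has a neighbour in A.
  -- Sets are represented as duplicate-free lists; size = length.
  IsTotalDominating : List V → Set
  IsTotalDominating A = ∀ (x : V) → ∃ λ a → a ∈ A × Adj x a

  GammaT≡ : ℕ → Set
  GammaT≡ k =
    (Σ (List V) λ A → Unique A × IsTotalDominating A × length A ≡ k)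
    × (∀ (A : List V) → Unique A → IsTotalDominating A → k ≤ length A)

  -- Legal sequence: for every position i ≥ 2, i.e. every split
  -- s = (y ∷ ys) ++ v ∷ zs with a nonempty prefix, N(v) has a vertex
  -- not in the union of the neighbourhoods of the earlier vertices.
  IsLegal : List V → Set
  IsLegal s = ∀ (y : V) (ys : List V) (v : V) (zs : List V) →
    s ≡ (y ∷ ys) ++ (v ∷ zs) →
    ∃ λ w → Adj v w × (∀ u → u ∈ (y ∷ ys) → ¬ Adj u w)

  IsTotalDominatingSequence : List V → Set
  IsTotalDominatingSequence s = Unique s × IsLegal s × IsTotalDominating s

  GammaGrT≡ : ℕ → Set
  GammaGrT≡ k =
    (Σ (List V) λ s → IsTotalDominatingSequence s × length s ≡ k)
    × (∀ (s : List V) → IsTotalDominatingSequence s → length s ≤ k)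

  TotalUniform : ℕ → Set
  TotalUniform k = GammaT≡ k × GammaGrT≡ k

-- The line graph L(K_n): vertices are 2-element subsets {i, j} of Fin n,
-- represented canonically as pairs (i , j) with i < j.
LKVertex : ℕ → Set
LKVertex n = Σ (Fin n × Fin n) λ p → proj₁ p F.< proj₂ p

LKAdj : (n : ℕ) → LKVertex n → LKVertex n → Set
LKAdj n ((i , j) , _) ((k , l) , _) =
  ¬ (i ≡ k × j ≡ l) × (i ≡ k ⊎ i ≡ l ⊎ j ≡ k ⊎ j ≡ l)

module Submission where

-- A sequence p is summarised by the set ⋃_{u ∈ p} N(u) it covers.  Computing every such set
-- reachable in three steps shows that no three vertices of L(K₆) cover all fifteen, so
-- γ_t ≥ 4.  Along a legal sequence every vertex after the first must enlarge the covered set;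
-- computing the sets reachable legally shows that after four vertices nothing is left, so no
-- legal sequence has five vertices.  The edges 01, 02, 34, 35 of K₆, in this order, form both
-- a total dominating set and a legal sequence.

open import Defs

open import Data.Bool using (Bool; true; false; _∨_; _∧_; not; T; T?)
import Data.Bool as Bool
open import Data.Bool.ListAction using (or)
open import Data.Bool.Properties using (∨-identityʳ; ∨-assoc; ∨-zeroʳ)
open import Data.Fin using (Fin; #_; _<?_)
import Data.Fin as Fin
open import Data.Fin.Properties using (<-irrelevant)
open import Data.List using (List; []; _∷_; _++_; _∷ʳ_; length; map; zipWith; concatMap; filterᵇ; deduplicate; mapMaybe; cartesianProduct; allFin)
open import Data.List.Properties using (≡-dec; ++-assoc; ++-identityʳ; map-cong)
open import Data.List.Membership.Propositional using (_∈_; _∉_; find; lose)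
open import Data.List.Membership.Propositional.Properties using (∈-concatMap⁺; ∈-map⁺; ∈-filter⁺; ∈-deduplicate⁺; ∈-cartesianProduct⁺; ∈-allFin)
open import Data.List.Membership.DecPropositional (≡-dec Bool._≟_) using (_∉?_)
open import Data.List.Relation.Unary.All as All using (All; []; _∷_)
open import Data.List.Relation.Unary.Any as Any using (Any; here; there; any?)
open import Data.List.Relation.Unary.Any.Properties using (mapMaybe⁺)
open import Data.List.Relation.Unary.AllPairs using ([]; _∷_)
open import Data.List.Relation.Unary.Unique.Propositional using (Unique)
open import Data.Maybe using (Maybe; just; nothing)
import Data.Maybe.Relation.Unary.Any as Maybe
open import Data.Nat using (ℕ; zero; suc; _+_; _≤_; _≤′_; ≤′-refl; ≤′-step; z≤n; s≤s; _≤?_)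
open import Data.Nat.Properties using (+-suc; +-identityʳ; ≤-pred; ≤⇒≤′; ≰⇒>)
open import Data.Product using (∃; _×_; _,_)
open import Data.Sum using (_⊎_; inj₁; inj₂)
open import Data.Unit using (tt)
open import Function using (_∘_)
open import Relation.Binary.Definitions using (Decidable; Symmetric)
open import Relation.Binary.PropositionalEquality using (_≡_; refl; sym; trans; cong; cong₂; subst; subst₂; module ≡-Reasoning)
open import Relation.Nullary using (¬_; Dec; yes; no; does; contradiction)
open import Relation.Nullary.Decidable using (True; toWitness; _×-dec_; _⊎-dec_; ¬?; from-yes; dec-true; dec-false; map′)

zipWith-map-self : ∀ {A B C : Set} (f : B → A → C) (g : A → B) xs →
                   zipWith f (map g xs) xs ≡ map (λ x → f (g x) x) xs
zipWith-map-self f g []       = refl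
zipWith-map-self f g (x ∷ xs) = cong (f (g x) x ∷_) (zipWith-map-self f g xs)

or-map-∈ : ∀ {A : Set} (f : A → Bool) {x xs} → x ∈ xs → f x ≡ true → or (map f xs) ≡ true
or-map-∈ f (here refl) fx rewrite fx = refl
or-map-∈ f {xs = y ∷ _} (there x∈xs) fx = trans (cong (f y ∨_) (or-map-∈ f x∈xs fx)) (∨-zeroʳ (f y))

module FiniteGraph {V : Set} {Adj : V → V → Set} (adj? : Decidable Adj)
                   (vertices : List V) (∈-vertices : ∀ v → v ∈ vertices) where

  adjᵇ : V → V → Bool
  adjᵇ u w = does (adj? u w)

  -- A set of vertices, as its characteristic vector along `vertices`.
  CoverState : Set
  CoverState = List Bool

  coveredBy : List V → V → Bool
  coveredBy p w = does (any? (λ u → adj? u w) p)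

  cover : List V → CoverState
  cover p = map (coveredBy p) vertices

  full : CoverState
  full = map (λ _ → true) vertices

  grow : CoverState → V → CoverState
  grow c v = zipWith (λ b w → b ∨ adjᵇ v w) c vertices

  hasFreshNeighbour : CoverState → V → Bool
  hasFreshNeighbour c v = or (zipWith (λ b w → not b ∧ adjᵇ v w) c vertices)

  coveredBy-∷ʳ : ∀ p v w → coveredBy (p ∷ʳ v) w ≡ coveredBy p w ∨ adjᵇ v w
  coveredBy-∷ʳ []      v w = ∨-identityʳ (adjᵇ v w)
  coveredBy-∷ʳ (u ∷ p) v w = begin
    adjᵇ u w ∨ coveredBy (p ∷ʳ v) w          ≡⟨ cong (adjᵇ u w ∨_) (coveredBy-∷ʳ p v w) ⟩
    adjᵇ u w ∨ (coveredBy p w ∨ adjᵇ v w)    ≡⟨ ∨-assoc (adjᵇ u w) (coveredBy p w) (adjᵇ v w) ⟨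
    (adjᵇ u w ∨ coveredBy p w) ∨ adjᵇ v w    ∎
    where open ≡-Reasoning

  cover-∷ʳ : ∀ p v → cover (p ∷ʳ v) ≡ grow (cover p) v
  cover-∷ʳ p v = trans (map-cong (λ w → coveredBy-∷ʳ p v w) vertices)
                       (sym (zipWith-map-self (λ b w → b ∨ adjᵇ v w) (coveredBy p) vertices))

  coveredBy-true : ∀ {p u w} → u ∈ p → Adj u w → coveredBy p w ≡ true
  coveredBy-true u∈p a = dec-true (any? _ _) (Any.map (λ { refl → a }) u∈p)

  coveredBy-false : ∀ {p w} → (∀ u → u ∈ p → ¬ Adj u w) → coveredBy p w ≡ false
  coveredBy-false h = dec-false (any? _ _) λ any → let (u , u∈p , a) = find any in h u u∈p a

  cover-full : ∀ {p} → (∀ w → ∃ λ u → u ∈ p × Adj u w) → cover p ≡ full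
  cover-full dom = map-cong (λ w → let (u , u∈p , a) = dom w in coveredBy-true u∈p a) vertices

  hasFreshNeighbour-cover : ∀ {p v} → (∃ λ w → Adj v w × (∀ u → u ∈ p → ¬ Adj u w)) →
                            hasFreshNeighbour (cover p) v ≡ true
  hasFreshNeighbour-cover {p} {v} (w , vw , fresh)
    rewrite zipWith-map-self (λ b w → not b ∧ adjᵇ v w) (coveredBy p) vertices
    = or-map-∈ (λ w → not (coveredBy p w) ∧ adjᵇ v w) (∈-vertices w)
        (cong₂ (λ b c → not b ∧ c) (coveredBy-false fresh) (dec-true (adj? v w) vw))

  successors : (CoverState → V → Bool) → List CoverState → List CoverState
  successors admissible cs =
    deduplicate (≡-dec Bool._≟_) (concatMap (λ c → map (grow c) (filterᵇ (admissible c) vertices)) cs)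

  ∈-successors : ∀ {admissible c cs} v → c ∈ cs → admissible c v ≡ true →
                 grow c v ∈ successors admissible cs
  ∈-successors {admissible} v c∈cs adm = ∈-deduplicate⁺ (≡-dec Bool._≟_)
    (∈-concatMap⁺ (λ c → map (grow c) (filterᵇ (admissible c) vertices))
      (Any.map (λ { refl → ∈-map⁺ _ (∈-filter⁺ (T? ∘ admissible _) (∈-vertices v) (subst T (sym adm) tt)) }) c∈cs))

  coverStates : ℕ → List CoverState
  coverStates zero    = cover [] ∷ []
  coverStates (suc k) = successors (λ _ _ → true) (coverStates k)

  -- Indexed by the number of vertices after the first, which is unconstrained.
  legalCoverStates : ℕ → List CoverState
  legalCoverStates zero    = coverStates 1
  legalCoverStates (suc k) = successors hasFreshNeighbour (legalCoverStates k)

  cover-∈-coverStates : ∀ p q {k} → cover p ∈ coverStates k →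
                        cover (p ++ q) ∈ coverStates (k + length q)
  cover-∈-coverStates p []      {k} p∈ rewrite ++-identityʳ p | +-identityʳ k = p∈
  cover-∈-coverStates p (v ∷ q) {k} p∈ =
    subst₂ (λ s n → cover s ∈ coverStates n) (++-assoc p (v ∷ []) q) (sym (+-suc k (length q)))
      (cover-∈-coverStates (p ∷ʳ v) q {suc k}
        (subst (_∈ coverStates (suc k)) (sym (cover-∷ʳ p v)) (∈-successors v p∈ refl)))

  cover-∈-legalCoverStates : ∀ y ys q {k} → IsLegal Adj (y ∷ ys ++ q) →
    cover (y ∷ ys) ∈ legalCoverStates k → cover (y ∷ ys ++ q) ∈ legalCoverStates (k + length q)
  cover-∈-legalCoverStates y ys []      {k} _ ys∈
    rewrite ++-identityʳ ys | +-identityʳ k = ys∈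
  cover-∈-legalCoverStates y ys (v ∷ q) {k} legal ys∈ =
    subst₂ (λ zs n → cover (y ∷ zs) ∈ legalCoverStates n) (++-assoc ys (v ∷ []) q) (sym (+-suc k (length q)))
      (cover-∈-legalCoverStates y (ys ∷ʳ v) q {suc k}
        (subst (λ zs → IsLegal Adj (y ∷ zs)) (sym (++-assoc ys (v ∷ []) q)) legal)
        (subst (_∈ legalCoverStates (suc k)) (sym (cover-∷ʳ (y ∷ ys) v))
          (∈-successors v ys∈ (hasFreshNeighbour-cover (legal y ys v q refl)))))

  totalDominating⇒full∈coverStates : Symmetric Adj → ∀ A → IsTotalDominating Adj A →
                                      full ∈ coverStates (length A)
  totalDominating⇒full∈coverStates symmetric A td =
    subst (_∈ coverStates (length A)) (cover-full dominated) (cover-∈-coverStates [] A {0} (here refl))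
    where
    dominated : ∀ w → ∃ λ u → u ∈ A × Adj u w
    dominated w = let (u , u∈A , wu) = td w in u , u∈A , symmetric wu

  legal⇒cover∈legalCoverStates : ∀ y ys → IsLegal Adj (y ∷ ys) → cover (y ∷ ys) ∈ legalCoverStates (length ys)
  legal⇒cover∈legalCoverStates y ys legal =
    cover-∈-legalCoverStates y [] ys {0} legal (cover-∈-coverStates [] (y ∷ []) {0} (here refl))

  totalDominating? : ∀ A → Dec (IsTotalDominating Adj A)
  totalDominating? A =
    map′ (λ dom x → find (All.lookup dom (∈-vertices x)))
         (λ td → All.tabulate λ {x} _ → let (a , a∈A , xa) = td x in lose a∈A xa)
         (All.all? (λ x → any? (adj? x) A) vertices)

  freshNeighbour? : ∀ p v → Dec (∃ λ w → Adj v w × (∀ u → u ∈ p → ¬ Adj u w))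
  freshNeighbour? p v =
    map′ (λ any → let (w , _ , vw , fresh) = find {P = λ w → Adj v w × All (λ u → ¬ Adj u w) p} any
                 in w , vw , λ u → All.lookup fresh)
         (λ (w , vw , fresh) → lose (∈-vertices w) (vw , All.tabulate (fresh _)))
         (any? (λ w → adj? v w ×-dec All.all? (λ u → ¬? (adj? u w)) p) vertices)

toLKVertex : ∀ {n} → Fin n × Fin n → Maybe (LKVertex n)
toLKVertex (i , j) with i <? j
... | yes i<j = just ((i , j) , i<j)
... | no _    = nothing

LKVertices : ∀ n → List (LKVertex n)
LKVertices n = mapMaybe toLKVertex (cartesianProduct (allFin n) (allFin n))

∈-LKVertices : ∀ {n} (v : LKVertex n) → v ∈ LKVertices n
∈-LKVertices v@((i , j) , i<j) =
  mapMaybe⁺ toLKVertex _ (Any.map (λ { refl → toLKVertex-just })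
    (∈-map⁺ toLKVertex (∈-cartesianProduct⁺ (∈-allFin i) (∈-allFin j))))
  where
  toLKVertex-just : Maybe.Any (v ≡_) (toLKVertex (i , j))
  toLKVertex-just with i <? j
  ... | yes i<j′ = Maybe.just (cong ((i , j) ,_) (<-irrelevant i<j i<j′))
  ... | no i≮j   = contradiction i<j i≮j

LKAdj? : ∀ n → Decidable (LKAdj n)
LKAdj? n ((i , j) , _) ((k , l) , _) =
  ¬? ((i Fin.≟ k) ×-dec (j Fin.≟ l)) ×-dec
  ((i Fin.≟ k) ⊎-dec (i Fin.≟ l) ⊎-dec (j Fin.≟ k) ⊎-dec (j Fin.≟ l))

LKAdj-sym : ∀ {n} → Symmetric (LKAdj n)
LKAdj-sym (distinct , shared) = (λ (k≡i , l≡j) → distinct (sym k≡i , sym l≡j)) , swap shared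
  where
  swap : ∀ {A : Set} {i j k l : A} → i ≡ k ⊎ i ≡ l ⊎ j ≡ k ⊎ j ≡ l → k ≡ i ⊎ k ≡ j ⊎ l ≡ i ⊎ l ≡ j
  swap (inj₁ i≡k)                   = inj₁ (sym i≡k)
  swap (inj₂ (inj₁ i≡l))            = inj₂ (inj₂ (inj₁ (sym i≡l)))
  swap (inj₂ (inj₂ (inj₁ j≡k)))     = inj₂ (inj₁ (sym j≡k))
  swap (inj₂ (inj₂ (inj₂ j≡l)))     = inj₂ (inj₂ (inj₂ (sym j≡l)))

open FiniteGraph (LKAdj? 6) (LKVertices 6) ∈-LKVertices

full∉coverStates : ∀ {k} → k ≤ 3 → full ∉ coverStates k
full∉coverStates z≤n                   = from-yes (full ∉? coverStates 0)
full∉coverStates (s≤s z≤n)             = from-yes (full ∉? coverStates 1)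
full∉coverStates (s≤s (s≤s z≤n))       = from-yes (full ∉? coverStates 2)
full∉coverStates (s≤s (s≤s (s≤s z≤n))) = from-yes (full ∉? coverStates 3)

legalCoverStates-vanish : ∀ {k} → 4 ≤′ k → legalCoverStates k ≡ []
legalCoverStates-vanish ≤′-refl     = refl
legalCoverStates-vanish (≤′-step h) rewrite legalCoverStates-vanish h = refl

totalDominating-length≥4 : ∀ A → IsTotalDominating (LKAdj 6) A → 4 ≤ length A
totalDominating-length≥4 A td with 4 ≤? length A
... | yes 4≤∣A∣ = 4≤∣A∣
... | no 4≰∣A∣  =
  -- LKAdj 6 computes on the η-expanded endpoints, so they cannot be inferred and are bound explicitly.
  contradiction (totalDominating⇒full∈coverStates (λ {u} {w} → LKAdj-sym {6} {u} {w}) A td)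
                (full∉coverStates (≤-pred (≰⇒> 4≰∣A∣)))

legal-length≤4 : ∀ s → IsLegal (LKAdj 6) s → length s ≤ 4
legal-length≤4 []       _ = z≤n
legal-length≤4 (y ∷ ys) legal with length ys ≤? 3
... | yes ∣ys∣≤3 = s≤s ∣ys∣≤3
... | no ∣ys∣≰3  = contradiction
  (subst (cover (y ∷ ys) ∈_) (legalCoverStates-vanish (≤⇒≤′ (≰⇒> ∣ys∣≰3)))
         (legal⇒cover∈legalCoverStates y ys legal))
  λ ()

edge : (i j : Fin 6) → {True (i <? j)} → LKVertex 6
edge i j {i<j} = (i , j) , toWitness i<j

e₀₁ e₀₂ e₃₄ e₃₅ : LKVertex 6
e₀₁ = edge (# 0) (# 1)
e₀₂ = edge (# 0) (# 2)
e₃₄ = edge (# 3) (# 4)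
e₃₅ = edge (# 3) (# 5)

E : List (LKVertex 6)
E = e₀₁ ∷ e₀₂ ∷ e₃₄ ∷ e₃₅ ∷ []

unique-E : Unique E
unique-E = ((λ ()) ∷ (λ ()) ∷ (λ ()) ∷ []) ∷ ((λ ()) ∷ (λ ()) ∷ []) ∷ ((λ ()) ∷ []) ∷ [] ∷ []

totalDominating-E : IsTotalDominating (LKAdj 6) E
totalDominating-E = from-yes (totalDominating? E)

legal-E : IsLegal (LKAdj 6) E
legal-E _ []                  _ _ refl = from-yes (freshNeighbour? (e₀₁ ∷ []) e₀₂)
legal-E _ (_ ∷ [])            _ _ refl = from-yes (freshNeighbour? (e₀₁ ∷ e₀₂ ∷ []) e₃₄)
legal-E _ (_ ∷ _ ∷ [])        _ _ refl = from-yes (freshNeighbour? (e₀₁ ∷ e₀₂ ∷ e₃₄ ∷ []) e₃₅)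
legal-E _ (_ ∷ _ ∷ _ ∷ [])    _ _ ()
legal-E _ (_ ∷ _ ∷ _ ∷ _ ∷ _) _ _ ()

proposition3p1 : TotalUniform (LKAdj 6) 4
proposition3p1 =
  ( (E , unique-E , totalDominating-E , refl)
  , λ A _ dominating → totalDominating-length≥4 A dominating )
  ,
  ( (E , (unique-E , legal-E , totalDominating-E) , refl)
  , λ s (_ , legal , _) → legal-length≤4 s legal )
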